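{- Let $(\langle G,m\rangle,p)$ be a periodic orbit framework on the $x$-variable torus $\mathcal T_x^2$ with $G$ connected, let $T$ be a spanning tree of $G$ with root $u$, and let $m_T$ be the resulting $T$-gain assignment. Define $p':V\to\mathbb R^2$ by $p'_i=p_i+m(v_i,T)L_x$, where $m(v_i,T)$ is the $T$-potential of $v_i$. Then $\operatorname{rank}\mathcal R_x(\langle G,m\rangle,p)=\operatorname{rank}\mathcal R_x(\langle G,m_T\rangle,p')$.
   Context: A periodic orbit graph $\langle G,m\rangle$ is a finite directed multigraph $G=(V,E)$ (loops, parallel edges allowed) with gains $m:E\to\mathbb Z^2$; $\{v_i,v_j;m_e\}$ denotes an edge from $v_i$ to $v_j$ with gain $m_e$, identified with $\{v_j,v_i;-m_e\}$. The net gain of a path is the sum of the gains of its edges, each with sign $+1$ or $-1$ according to whether it is traversed along or against its direction. Fix reals $y_1,y_2$ and let $L_x=\begin{pmatrix}x&0\\ y_1&y_2\end{pmatrix}$; for a row vector $z\in\mathbb Z^2$, $zL_x\in\mathbb R^2$. For $p:V\to\mathbb R^2$, $p_i=p(v_i)$, the rigidity matrix $\mathcal R_x(\langle G,m\rangle,p)$ is the $|E|\times(2|V|+1)$ matrix whose row for $e=\{v_i,v_j;m_e\}$ has $p_i-(p_j+m_eL_x)$ in the two columns of $v_i$, $(p_j+m_eL_x)-p_i$ in the two columns of $v_j$ (added if $i=j$), zeros in other vertex columns, and $(m_e)_x[p_i-(p_j+m_eL_x)]_x$ in the last column, $(\cdot)_x$ denoting the first coordinate. $T$-gain procedure: the $T$-potential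 $m(v,T)$ of a vertex $v$ is the net gain of the unique path in $T$ from the root $u$ to $v$; for an edge $e$ directed from $v$ to $w$, its $T$-gain is $m_T(e)=m(v,T)+m(e)-m(w,T)$. -}

module Defs where

open import Level using (Level; _⊔_) renaming (suc to lsuc)
open import Algebra.Bundles using (CommutativeRing)
open import Data.Nat as ℕ using (ℕ)
open import Data.Integer as ℤ using (ℤ; +_; -[1+_])
open import Data.Fin using (Fin; zero; suc; _≟_)
open import Data.Product using (_×_; _,_; proj₁; proj₂; Σ; ∃)
open import Data.Sum using (_⊎_; inj₁; inj₂)
open import Data.Unit using (⊤; tt)
open import Data.Bool using (Bool; true)
open import Data.List using (List; []; _∷_)
open import Data.List.Relation.Unary.Unique.Propositional using (Unique)
open import Relation.Nullary using (¬_; yes; no)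
open import Relation.Binary.PropositionalEquality using (_≡_)
import Algebra.Definitions.RawMonoid as RawMonoidDefs

-- Fields (the statement is algebraic; ℝ is one instance)

record Field (c ℓ : Level) : Set (lsuc (c ⊔ ℓ)) where
  field
    commutativeRing : CommutativeRing c ℓ
  open CommutativeRing commutativeRing public
  field
    0≉1     : ¬ (0# ≈ 1#)
    inverse : ∀ x → ¬ (x ≈ 0#) → Σ Carrier (λ y → x * y ≈ 1#)

Gain : Set
Gain = ℤ × ℤ

_+ᵍ_ : Gain → Gain → Gain
(a , b) +ᵍ (c , d) = (a ℤ.+ c , b ℤ.+ d)

-ᵍ_ : Gain → Gain
-ᵍ (a , b) = (ℤ.- a , ℤ.- b)

_-ᵍ_ : Gain → Gain → Gain
g -ᵍ h = g +ᵍ (-ᵍ h)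

0ᵍ : Gain
0ᵍ = (+ 0 , + 0)

-- Periodic orbit graphs: vertices Fin n, edges Fin k,
-- edge e goes from src e to tgt e and carries gain (gain e) ∈ ℤ².
-- Loops and parallel edges are allowed.

record GainGraph (n k : ℕ) : Set where
  constructor mkGainGraph
  field
    src  : Fin k → Fin n
    tgt  : Fin k → Fin n
    gain : Fin k → Gain
open GainGraph public

withGains : ∀ {n k} → GainGraph n k → (Fin k → Gain) → GainGraph n k
withGains G m = mkGainGraph (src G) (tgt G) m

-- Walks in the underlying undirected graph using only edges in a set S
-- (S : Fin k → Bool).  Each step traverses an edge along (+1) or
-- against (−1) its direction.

module _ {n k : ℕ} (G : GainGraph n k) (S : Fin k → Bool) where

  data Walk : Fin n → Fin n → Set where
    [] : ∀ {a} → Walk a a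
    fwd : ∀ {b} (e : Fin k) → S e ≡ true → Walk (tgt G e) b → Walk (src G e) b
    bwd : ∀ {b} (e : Fin k) → S e ≡ true → Walk (src G e) b → Walk (tgt G e) b

  vertices : ∀ {a b} → Walk a b → List (Fin n)
  vertices {a} []          = a ∷ []
  vertices {a} (fwd e _ w) = a ∷ vertices w
  vertices {a} (bwd e _ w) = a ∷ vertices w

  IsPath : ∀ {a b} → Walk a b → Set
  IsPath w = Unique (vertices w)

  Path : Fin n → Fin n → Set
  Path a b = Σ (Walk a b) IsPath

  netGain : ∀ {a b} → Walk a b → Gain
  netGain []          = 0ᵍ
  netGain (fwd e _ w) = gain G e +ᵍ netGain w
  netGain (bwd e _ w) = (-ᵍ gain G e) +ᵍ netGain w

allEdges : ∀ {k} → Fin k → Bool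
allEdges _ = true

Connected : ∀ {n k} → GainGraph n k → Set
Connected G = ∀ a b → Path G allEdges a b

IsSpanningTree : ∀ {n k} → GainGraph n k → (Fin k → Bool) → Set
IsSpanningTree G T =
  ∀ a b → Path G T a b × (∀ (P Q : Path G T a b) → proj₁ P ≡ proj₁ Q)

IsTPotential : ∀ {n k} → GainGraph n k → (Fin k → Bool) → Fin n → (Fin n → Gain) → Set
IsTPotential G T u pot = ∀ v (P : Path G T u v) → pot v ≡ netGain G T (proj₁ P)

TGain : ∀ {n k} → GainGraph n k → (Fin n → Gain) → Fin k → Gain
TGain G pot e = (pot (src G e) +ᵍ gain G e) -ᵍ pot (tgt G e)

module LinAlg {c ℓ} (F : Field c ℓ) where
  open Field F using (Carrier; _≈_; _+_; _*_; -_; _-_; 0#; 1#; +-rawMonoid)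
  open RawMonoidDefs +-rawMonoid using () renaming (_×_ to _·ℕ_)

  fromℤ : ℤ → Carrier
  fromℤ (+ m)    = m ·ℕ 1#
  fromℤ -[1+ m ] = - (ℕ.suc m ·ℕ 1#)

  Vec2 : Set c
  Vec2 = Carrier × Carrier

  _⊕_ : Vec2 → Vec2 → Vec2
  (a , b) ⊕ (c' , d) = (a + c' , b + d)

  _⊖_ : Vec2 → Vec2 → Vec2
  (a , b) ⊖ (c' , d) = (a - c' , b - d)

  -- z L_x for z = (z₁ , z₂), L_x = [[x , 0] , [y₁ , y₂]]
  mulL : (x y₁ y₂ : Carrier) → Gain → Vec2
  mulL x y₁ y₂ (z₁ , z₂) = (fromℤ z₁ * x + fromℤ z₂ * y₁ , fromℤ z₂ * y₂)

  coord : Fin 2 → Vec2 → Carrier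
  coord zero          (a , _) = a
  coord (suc zero)    (_ , b) = b

  sumF : (r : ℕ) → (Fin r → Carrier) → Carrier
  sumF ℕ.zero    f = 0#
  sumF (ℕ.suc r) f = f zero + sumF r (λ i → f (suc i))

  Col : ℕ → Set
  Col n = (Fin n × Fin 2) ⊎ ⊤

  rigidity : ∀ {n k} (x y₁ y₂ : Carrier) → GainGraph n k → (Fin n → Vec2)
           → Fin k → Col n → Carrier
  rigidity x y₁ y₂ G p e col = entry col
    where
      i = src G e
      j = tgt G e
      d : Vec2
      d = p i ⊖ (p j ⊕ mulL x y₁ y₂ (gain G e))
      at : Fin _ → Fin 2 → Carrier
      at w t with w ≟ i | w ≟ j
      ... | yes _ | yes _ = coord t d + (- coord t d)
      ... | yes _ | no _  = coord t d
      ... | no _  | yes _ = - coord t d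
      ... | no _  | no _  = 0#
      entry : Col _ → Carrier
      entry (inj₁ (w , t)) = at w t
      entry (inj₂ tt)      = fromℤ (proj₁ (gain G e)) * coord zero d

  RowsIndependent : ∀ {R C : Set} → (R → C → Carrier) → ∀ {s} → (Fin s → R) → Set (c ⊔ ℓ)
  RowsIndependent M {s} S =
    ∀ (λs : Fin s → Carrier) →
      (∀ col → sumF s (λ i → λs i * M (S i) col) ≈ 0#) →
      ∀ i → λs i ≈ 0#

  HasRank : ∀ {R C : Set} → (R → C → Carrier) → ℕ → Set (c ⊔ ℓ)
  HasRank {R} M r =
    Σ (Fin r → R) (λ S → RowsIndependent M S) ×
    (∀ (S : Fin (ℕ.suc r) → R) → ¬ RowsIndependent M S)

-- For an edge e from i to j let d_e = p_i − (p_j + m_e L_x) be its displacement.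
-- With T-gains m_T(e) = π_i + m_e − π_j and positions p′_i = p_i + π_i L_x,
-- every displacement is unchanged, since z ↦ z L_x is additive and the
-- translations by π_i L_x and π_j L_x cancel.  So both rigidity matrices agree
-- in the vertex columns, while the last entry of row e grows by
-- ((π_i)_x − (π_j)_x)(d_e)_x = Σ_v (π_v)_x · R[e , (v , x)]: a column operation.
-- Column operations keep all linear relations among rows, and HasRank depends
-- only on those relations.  The argument works for any potential π : V → ℤ².

module Submission where

open import Defs
open import Level using (_⊔_)
open import Data.Nat as ℕ using (ℕ)
open import Data.Integer as ℤ using (ℤ; +_; -[1+_])
import Data.Integer.Properties as ℤ
import Data.Nat.Properties as ℕ
open import Data.Bool using (Bool)
open import Data.Product using (_×_; _,_; proj₁; proj₂)
open import Data.Fin using (Fin; zero; suc; _≟_)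
open import Data.Sum using (inj₁; inj₂)
open import Data.Unit using (tt)
open import Data.Maybe using (Maybe; just; nothing)
open import Relation.Nullary using (¬_; yes; no; contradiction)
open import Function.Bundles using (_⇔_; mk⇔)
open import Relation.Binary.PropositionalEquality as ≡ using (_≡_)
import Algebra.Properties.Ring as RingProperties
import Algebra.Properties.CommutativeSemigroup as CommutativeSemigroupProperties
import Algebra.Properties.Semiring.Mult as SemiringMult
import Algebra.Solver.Ring.AlmostCommutativeRing as AlmostCommutativeRing
import Algebra.Solver.Ring as RingSolver

module RigidityRank {c ℓ} (F : Field c ℓ) where
  open Field F hiding (zero)
  open LinAlg F
  open RingProperties ring
  open SemiringMult semiring using (×1-homo-*; ×-homo-+)
  open CommutativeSemigroupProperties +-commutativeSemigroup using (interchange)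
  open CommutativeSemigroupProperties *-commutativeSemigroup using (x∙yz≈y∙xz)
  open import Relation.Binary.Reasoning.Setoid setoid

  fromℤ-neg : ∀ z → fromℤ (ℤ.- z) ≈ - fromℤ z
  fromℤ-neg (+ ℕ.zero)  = sym -0#≈0#
  fromℤ-neg (+ ℕ.suc n) = refl
  fromℤ-neg -[1+ n ]    = sym (-‿involutive _)

  fromℤ-⊖ : ∀ m n → fromℤ (m ℤ.⊖ n) ≈ fromℤ (+ m) - fromℤ (+ n)
  fromℤ-⊖ ℕ.zero    ℕ.zero    = sym (trans (+-congˡ -0#≈0#) (+-identityʳ _))
  fromℤ-⊖ (ℕ.suc m) ℕ.zero    = sym (trans (+-congˡ -0#≈0#) (+-identityʳ _))
  fromℤ-⊖ ℕ.zero    (ℕ.suc n) = sym (+-identityˡ _)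
  fromℤ-⊖ (ℕ.suc m) (ℕ.suc n) rewrite ℤ.[1+m]⊖[1+n]≡m⊖n m n =
    trans (fromℤ-⊖ m n) (sym (cancel-1# (fromℤ (+ m)) (fromℤ (+ n))))
    where
    cancel-1# : ∀ a b → (1# + a) - (1# + b) ≈ a - b
    cancel-1# a b = begin
      (1# + a) + - (1# + b)   ≈⟨ +-congˡ (sym (-‿+-comm 1# b)) ⟩
      (1# + a) + (- 1# + - b) ≈⟨ interchange 1# a (- 1#) (- b) ⟩
      (1# - 1#) + (a - b)     ≈⟨ +-congʳ (-‿inverseʳ 1#) ⟩
      0# + (a - b)            ≈⟨ +-identityˡ _ ⟩
      a - b                   ∎

  fromℤ-+ : ∀ a b → fromℤ (a ℤ.+ b) ≈ fromℤ a + fromℤ b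
  fromℤ-+ (+ m)    (+ n)    = ×-homo-+ 1# m n
  fromℤ-+ (+ m)    -[1+ n ] = fromℤ-⊖ m (ℕ.suc n)
  fromℤ-+ -[1+ m ] (+ n)    = trans (fromℤ-⊖ n (ℕ.suc m)) (+-comm _ _)
  fromℤ-+ -[1+ m ] -[1+ n ] = begin
    - fromℤ (+ ℕ.suc (ℕ.suc (m ℕ.+ n)))
      ≡⟨ ≡.cong (λ k → - fromℤ (+ k)) (≡.sym (ℕ.+-suc (ℕ.suc m) n)) ⟩
    - fromℤ (+ (ℕ.suc m ℕ.+ ℕ.suc n))
      ≈⟨ -‿cong (×-homo-+ 1# (ℕ.suc m) (ℕ.suc n)) ⟩
    - (fromℤ (+ ℕ.suc m) + fromℤ (+ ℕ.suc n))
      ≈⟨ sym (-‿+-comm _ _) ⟩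
    - fromℤ (+ ℕ.suc m) + - fromℤ (+ ℕ.suc n) ∎

  fromℤ-* : ∀ a b → fromℤ (a ℤ.* b) ≈ fromℤ a * fromℤ b
  fromℤ-* (+ m)    b = fromℤ-+* m b
    where
    fromℤ-+*+ : ∀ m n → fromℤ (+ m ℤ.* + n) ≈ fromℤ (+ m) * fromℤ (+ n)
    fromℤ-+*+ m n rewrite ≡.sym (ℤ.pos-* m n) = ×1-homo-* m n

    fromℤ-+* : ∀ m b → fromℤ (+ m ℤ.* b) ≈ fromℤ (+ m) * fromℤ b
    fromℤ-+* m (+ n)    = fromℤ-+*+ m n
    fromℤ-+* m -[1+ n ] = begin
      fromℤ (+ m ℤ.* ℤ.- (+ ℕ.suc n))
        ≡⟨ ≡.cong fromℤ (≡.sym (ℤ.neg-distribʳ-* (+ m) (+ ℕ.suc n))) ⟩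
      fromℤ (ℤ.- (+ m ℤ.* + ℕ.suc n))       ≈⟨ fromℤ-neg (+ m ℤ.* + ℕ.suc n) ⟩
      - fromℤ (+ m ℤ.* + ℕ.suc n)           ≈⟨ -‿cong (fromℤ-+*+ m (ℕ.suc n)) ⟩
      - (fromℤ (+ m) * fromℤ (+ ℕ.suc n))   ≈⟨ -‿distribʳ-* _ _ ⟩
      fromℤ (+ m) * - fromℤ (+ ℕ.suc n)     ∎
  fromℤ-* -[1+ m ] b = begin
    fromℤ (ℤ.- (+ ℕ.suc m) ℤ.* b)
      ≡⟨ ≡.cong fromℤ (≡.sym (ℤ.neg-distribˡ-* (+ ℕ.suc m) b)) ⟩
    fromℤ (ℤ.- (+ ℕ.suc m ℤ.* b))        ≈⟨ fromℤ-neg (+ ℕ.suc m ℤ.* b) ⟩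
    - fromℤ (+ ℕ.suc m ℤ.* b)            ≈⟨ -‿cong (fromℤ-* (+ ℕ.suc m) b) ⟩
    - (fromℤ (+ ℕ.suc m) * fromℤ b)      ≈⟨ -‿distribˡ-* _ _ ⟩
    - fromℤ (+ ℕ.suc m) * fromℤ b        ∎

  fromℤ-affine : ∀ a m b → fromℤ ((a ℤ.+ m) ℤ.- b) ≈ (fromℤ a + fromℤ m) - fromℤ b
  fromℤ-affine a m b = trans (fromℤ-+ (a ℤ.+ m) (ℤ.- b)) (+-cong (fromℤ-+ a m) (fromℤ-neg b))

  private
    F-ring : AlmostCommutativeRing.AlmostCommutativeRing c ℓ
    F-ring = AlmostCommutativeRing.fromCommutativeRing commutativeRing

    fromℤ-homomorphism : ℤ.+-*-rawRing AlmostCommutativeRing.-Raw-AlmostCommutative⟶ F-ring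
    fromℤ-homomorphism = record
      { ⟦_⟧ = fromℤ ; +-homo = fromℤ-+ ; *-homo = fromℤ-* ; -‿homo = fromℤ-neg
      ; 0-homo = refl ; 1-homo = +-identityʳ 1# }

    fromℤ-≟ : ∀ a b → Maybe (fromℤ a ≈ fromℤ b)
    fromℤ-≟ a b with a ℤ.≟ b
    ... | yes ≡.refl = just refl
    ... | no _       = nothing

  open RingSolver ℤ.+-*-rawRing F-ring fromℤ-homomorphism fromℤ-≟
    using (solve; _:=_; _:+_; _:-_; _:*_)

  sumF-cong : ∀ r {f g : Fin r → Carrier} → (∀ i → f i ≈ g i) → sumF r f ≈ sumF r g
  sumF-cong ℕ.zero    f≈g = refl
  sumF-cong (ℕ.suc r) f≈g = +-cong (f≈g zero) (sumF-cong r (λ i → f≈g (suc i)))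

  sumF-zero : ∀ r {f : Fin r → Carrier} → (∀ i → f i ≈ 0#) → sumF r f ≈ 0#
  sumF-zero ℕ.zero    f≈0 = refl
  sumF-zero (ℕ.suc r) f≈0 =
    trans (+-cong (f≈0 zero) (sumF-zero r (λ i → f≈0 (suc i)))) (+-identityˡ 0#)

  sumF-+ : ∀ r (f g : Fin r → Carrier) → sumF r (λ i → f i + g i) ≈ sumF r f + sumF r g
  sumF-+ ℕ.zero    f g = sym (+-identityˡ 0#)
  sumF-+ (ℕ.suc r) f g = trans (+-congˡ (sumF-+ r _ _)) (interchange _ _ _ _)

  sumF-neg : ∀ r (f : Fin r → Carrier) → sumF r (λ i → - f i) ≈ - sumF r f
  sumF-neg ℕ.zero    f = sym -0#≈0#
  sumF-neg (ℕ.suc r) f = trans (+-congˡ (sumF-neg r _)) (-‿+-comm _ _)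

  sumF-- : ∀ r (f g : Fin r → Carrier) → sumF r (λ i → f i - g i) ≈ sumF r f - sumF r g
  sumF-- r f g = trans (sumF-+ r f (λ i → - g i)) (+-congˡ (sumF-neg r g))

  sumF-*ˡ : ∀ r (a : Carrier) (f : Fin r → Carrier) → sumF r (λ i → a * f i) ≈ a * sumF r f
  sumF-*ˡ ℕ.zero    a f = sym (zeroʳ a)
  sumF-*ˡ (ℕ.suc r) a f = trans (+-congˡ (sumF-*ˡ r a _)) (sym (distribˡ a _ _))

  sumF-*ʳ : ∀ r (f : Fin r → Carrier) (a : Carrier) → sumF r (λ i → f i * a) ≈ sumF r f * a
  sumF-*ʳ r f a = trans (sumF-cong r (λ i → *-comm _ _)) (trans (sumF-*ˡ r a f) (*-comm _ _))

  sumF-swap : ∀ r n (f : Fin r → Fin n → Carrier) →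
    sumF r (λ i → sumF n (f i)) ≈ sumF n (λ v → sumF r (λ i → f i v))
  sumF-swap ℕ.zero    n f = sym (sumF-zero n (λ _ → refl))
  sumF-swap (ℕ.suc r) n f = trans (+-congˡ (sumF-swap r n _)) (sym (sumF-+ n _ _))

  δ : ∀ {n} → Fin n → Fin n → Carrier
  δ zero    zero    = 1#
  δ zero    (suc _) = 0#
  δ (suc _) zero    = 0#
  δ (suc v) (suc w) = δ v w

  δ-≡ : ∀ {n} {v w : Fin n} → v ≡ w → δ v w ≈ 1#
  δ-≡ {v = zero}  ≡.refl = refl
  δ-≡ {v = suc v} ≡.refl = δ-≡ {v = v} ≡.refl

  δ-≢ : ∀ {n} {v w : Fin n} → ¬ v ≡ w → δ v w ≈ 0#
  δ-≢ {v = zero}  {zero}  v≢w = contradiction ≡.refl v≢w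
  δ-≢ {v = zero}  {suc w} v≢w = refl
  δ-≢ {v = suc v} {zero}  v≢w = refl
  δ-≢ {v = suc v} {suc w} v≢w = δ-≢ (λ v≡w → v≢w (≡.cong suc v≡w))

  sumF-δ : ∀ n (a : Fin n → Carrier) (w : Fin n) → sumF n (λ v → a v * δ v w) ≈ a w
  sumF-δ (ℕ.suc n) a zero = begin
    a zero * 1# + sumF n (λ v → a (suc v) * 0#) ≈⟨ +-cong (*-identityʳ _) (sumF-zero n (λ _ → zeroʳ _)) ⟩
    a zero + 0#                                 ≈⟨ +-identityʳ _ ⟩
    a zero                                      ∎
  sumF-δ (ℕ.suc n) a (suc w) = begin
    a zero * 0# + sumF n (λ v → a (suc v) * δ v w) ≈⟨ +-cong (zeroʳ _) (sumF-δ n (λ v → a (suc v)) w) ⟩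
    0# + a (suc w)                                 ≈⟨ +-identityˡ _ ⟩
    a (suc w)                                      ∎

  difference-scaled : ∀ {α β α′ β′} D → α ≈ α′ → β ≈ β′ → (α - β) * D ≈ α′ * D - β′ * D
  difference-scaled D α≈ β≈ = trans (*-congʳ (+-cong α≈ (-‿cong β≈))) ([y-z]x≈yx-zx D _ _)

  sumF-incidence : ∀ n (a : Fin n → Carrier) (i j : Fin n) →
    sumF n (λ v → a v * (δ v i - δ v j)) ≈ a i - a j
  sumF-incidence n a i j = begin
    sumF n (λ v → a v * (δ v i - δ v j))            ≈⟨ sumF-cong n (λ v → x[y-z]≈xy-xz (a v) _ _) ⟩
    sumF n (λ v → a v * δ v i - a v * δ v j)        ≈⟨ sumF-- n _ _ ⟩
    sumF n (λ v → a v * δ v i) - sumF n (λ v → a v * δ v j) ≈⟨ +-cong (sumF-δ n a i) (-‿cong (sumF-δ n a j)) ⟩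
    a i - a j                                        ∎

  -- Rank only depends on the linear relations among rows.

  module _ {R C : Set} where

    RowRelation : (R → C → Carrier) → ∀ {s} → (Fin s → R) → (Fin s → Carrier) → Set ℓ
    RowRelation M {s} S λs = ∀ col → sumF s (λ i → λs i * M (S i) col) ≈ 0#

    SameRowRelations : (R → C → Carrier) → (R → C → Carrier) → Set (c ⊔ ℓ)
    SameRowRelations M M′ =
      ∀ {s} (S : Fin s → R) (λs : Fin s → Carrier) →
        (RowRelation M S λs → RowRelation M′ S λs) × (RowRelation M′ S λs → RowRelation M S λs)

    same-sym : ∀ {M M′ : R → C → Carrier} → SameRowRelations M M′ → SameRowRelations M′ M
    same-sym same S λs = proj₂ (same S λs) , proj₁ (same S λs)

    independence-transfer : ∀ {M M′ : R → C → Carrier} → SameRowRelations M M′ →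
      ∀ {s} (S : Fin s → R) → RowsIndependent M′ S → RowsIndependent M S
    independence-transfer same S indep λs rel = indep λs (proj₁ (same S λs) rel)

    rank-transfer : ∀ (M M′ : R → C → Carrier) → SameRowRelations M M′ →
                    ∀ {r} → HasRank M r → HasRank M′ r
    rank-transfer M M′ same ((S , indep) , maximal) =
      (S , independence-transfer {M′} {M} (same-sym {M} {M′} same) S indep) ,
      (λ S′ indep′ → maximal S′ (independence-transfer {M} {M′} same S′ indep′))

    rank-invariant : ∀ (M M′ : R → C → Carrier) → SameRowRelations M M′ →
                     ∀ r → HasRank M r ⇔ HasRank M′ r
    rank-invariant M M′ same r =
      mk⇔ (rank-transfer M M′ same) (rank-transfer M′ M (same-sym {M} {M′} same))

  column-operation : ∀ {R : Set} {n} (M M′ : R → Col n → Carrier) (a : Fin n → Carrier) →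
    (∀ e w t → M′ e (inj₁ (w , t)) ≈ M e (inj₁ (w , t))) →
    (∀ e → M′ e (inj₂ tt) ≈ M e (inj₂ tt) + sumF n (λ v → a v * M e (inj₁ (v , zero)))) →
    SameRowRelations M M′
  column-operation {R} {n} M M′ a vertex-same last-shift {s} S λs = forward , backward
    where
    combine : (R → Col n → Carrier) → Col n → Carrier
    combine X col = sumF s (λ i → λs i * X (S i) col)

    vertex : ∀ w t → combine M′ (inj₁ (w , t)) ≈ combine M (inj₁ (w , t))
    vertex w t = sumF-cong s (λ i → *-congˡ (vertex-same (S i) w t))

    last : combine M′ (inj₂ tt) ≈ combine M (inj₂ tt) + sumF n (λ v → a v * combine M (inj₁ (v , zero)))
    last = begin
      combine M′ (inj₂ tt)
        ≈⟨ sumF-cong s (λ i → trans (*-congˡ (last-shift (S i))) (distribˡ _ _ _)) ⟩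
      sumF s (λ i → λs i * M (S i) (inj₂ tt) + λs i * sumF n (λ v → a v * M (S i) (inj₁ (v , zero))))
        ≈⟨ sumF-+ s _ _ ⟩
      combine M (inj₂ tt) + sumF s (λ i → λs i * sumF n (λ v → a v * M (S i) (inj₁ (v , zero))))
        ≈⟨ +-congˡ (sumF-cong s (λ i → sym (sumF-*ˡ n _ _))) ⟩
      combine M (inj₂ tt) + sumF s (λ i → sumF n (λ v → λs i * (a v * M (S i) (inj₁ (v , zero)))))
        ≈⟨ +-congˡ (sumF-swap s n _) ⟩
      combine M (inj₂ tt) + sumF n (λ v → sumF s (λ i → λs i * (a v * M (S i) (inj₁ (v , zero)))))
        ≈⟨ +-congˡ (sumF-cong n (λ v → trans (sumF-cong s (λ i → x∙yz≈y∙xz _ _ _)) (sumF-*ˡ s _ _))) ⟩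
      combine M (inj₂ tt) + sumF n (λ v → a v * combine M (inj₁ (v , zero))) ∎

    unchanged-last : (∀ v → combine M (inj₁ (v , zero)) ≈ 0#) → combine M′ (inj₂ tt) ≈ combine M (inj₂ tt)
    unchanged-last x-zero =
      trans last (trans (+-congˡ (sumF-zero n (λ v → trans (*-congˡ (x-zero v)) (zeroʳ _)))) (+-identityʳ _))

    forward : RowRelation M S λs → RowRelation M′ S λs
    forward rel (inj₁ (w , t)) = trans (vertex w t) (rel _)
    forward rel (inj₂ tt)      = trans (unchanged-last (λ v → rel _)) (rel _)

    backward : RowRelation M′ S λs → RowRelation M S λs
    backward rel′ (inj₁ (w , t)) = trans (sym (vertex w t)) (rel′ _)
    backward rel′ (inj₂ tt)      =
      trans (sym (unchanged-last (λ v → trans (sym (vertex v zero)) (rel′ _)))) (rel′ _)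

  -- The rigidity matrices before and after passing to T-gains.

  _≋_ : Vec2 → Vec2 → Set ℓ
  u ≋ v = ∀ t → coord t u ≈ coord t v

  translation-cancels : ∀ P Q A B M V → V ≈ (A + M) - B → (P + A) - ((Q + B) + V) ≈ P - (Q + M)
  translation-cancels P Q A B M V V≈ = trans (+-congˡ (-‿cong (+-congˡ V≈)))
    (solve 5 (λ P Q A B M → (P :+ A) :- ((Q :+ B) :+ ((A :+ M) :- B)) := P :- (Q :+ M)) refl P Q A B M)

  module Frameworks (x y₁ y₂ : Carrier) {n k : ℕ} (G : GainGraph n k)
                    (p : Fin n → Vec2) (pot : Fin n → Gain) where

    L : Gain → Vec2
    L = mulL x y₁ y₂

    p′ : Fin n → Vec2
    p′ i = p i ⊕ L (pot i)

    G′ : GainGraph n k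
    G′ = withGains G (TGain G pot)

    R R′ : Fin k → Col n → Carrier
    R  = rigidity x y₁ y₂ G p
    R′ = rigidity x y₁ y₂ G′ p′

    d d′ : Fin k → Vec2
    d  e = p  (src G e) ⊖ (p  (tgt G e) ⊕ L (gain G e))
    d′ e = p′ (src G e) ⊖ (p′ (tgt G e) ⊕ L (TGain G pot e))

    -- z ↦ z L_x is additive, so it maps a T-gain to the matching combination.
    L-TGain : ∀ e → L (TGain G pot e) ≋ ((L (pot (src G e)) ⊕ L (gain G e)) ⊖ L (pot (tgt G e)))
    L-TGain e zero = begin
      fromℤ ((a₁ ℤ.+ m₁) ℤ.- b₁) * x + fromℤ ((a₂ ℤ.+ m₂) ℤ.- b₂) * y₁
        ≈⟨ +-cong (*-congʳ (fromℤ-affine a₁ m₁ b₁)) (*-congʳ (fromℤ-affine a₂ m₂ b₂)) ⟩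
      ((A₁ + M₁) - B₁) * x + ((A₂ + M₂) - B₂) * y₁
        ≈⟨ solve 8 (λ A₁ A₂ M₁ M₂ B₁ B₂ x y₁ →
                    ((A₁ :+ M₁) :- B₁) :* x :+ ((A₂ :+ M₂) :- B₂) :* y₁
                    := ((A₁ :* x :+ A₂ :* y₁) :+ (M₁ :* x :+ M₂ :* y₁)) :- (B₁ :* x :+ B₂ :* y₁))
                 refl A₁ A₂ M₁ M₂ B₁ B₂ x y₁ ⟩
      ((A₁ * x + A₂ * y₁) + (M₁ * x + M₂ * y₁)) - (B₁ * x + B₂ * y₁) ∎
      where
      a₁ = proj₁ (pot (src G e)) ; a₂ = proj₂ (pot (src G e))
      m₁ = proj₁ (gain G e)      ; m₂ = proj₂ (gain G e)
      b₁ = proj₁ (pot (tgt G e)) ; b₂ = proj₂ (pot (tgt G e))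
      A₁ = fromℤ a₁ ; A₂ = fromℤ a₂ ; M₁ = fromℤ m₁ ; M₂ = fromℤ m₂ ; B₁ = fromℤ b₁ ; B₂ = fromℤ b₂
    L-TGain e (suc zero) = begin
      fromℤ ((a₂ ℤ.+ m₂) ℤ.- b₂) * y₂    ≈⟨ *-congʳ (fromℤ-affine a₂ m₂ b₂) ⟩
      ((A₂ + M₂) - B₂) * y₂              ≈⟨ solve 4 (λ A₂ M₂ B₂ y₂ →
                                               ((A₂ :+ M₂) :- B₂) :* y₂ := (A₂ :* y₂ :+ M₂ :* y₂) :- B₂ :* y₂)
                                             refl A₂ M₂ B₂ y₂ ⟩
      (A₂ * y₂ + M₂ * y₂) - B₂ * y₂      ∎
      where
      a₂ = proj₂ (pot (src G e)) ; m₂ = proj₂ (gain G e) ; b₂ = proj₂ (pot (tgt G e))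
      A₂ = fromℤ a₂ ; M₂ = fromℤ m₂ ; B₂ = fromℤ b₂

    displacement-invariant : ∀ e → d′ e ≋ d e
    displacement-invariant e zero       = translation-cancels _ _ _ _ _ _ (L-TGain e zero)
    displacement-invariant e (suc zero) = translation-cancels _ _ _ _ _ _ (L-TGain e (suc zero))

    vertex-columns-agree : ∀ e w t → R′ e (inj₁ (w , t)) ≈ R e (inj₁ (w , t))
    vertex-columns-agree e w t with w ≟ src G e | w ≟ tgt G e
    ... | yes _ | yes _ = +-cong (displacement-invariant e t) (-‿cong (displacement-invariant e t))
    ... | yes _ | no _  = displacement-invariant e t
    ... | no _  | yes _ = -‿cong (displacement-invariant e t)
    ... | no _  | no _  = refl

    vertex-entry : ∀ e w t → R e (inj₁ (w , t)) ≈ (δ w (src G e) - δ w (tgt G e)) * coord t (d e)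
    vertex-entry e w t with w ≟ src G e | w ≟ tgt G e
    ... | yes w≡i | yes w≡j = sym (trans (difference-scaled _ (δ-≡ w≡i) (δ-≡ w≡j))
                                         (+-cong (*-identityˡ _) (-‿cong (*-identityˡ _))))
    ... | yes w≡i | no w≢j  = sym (trans (difference-scaled _ (δ-≡ w≡i) (δ-≢ w≢j))
                                         (trans (+-cong (*-identityˡ _) (trans (-‿cong (zeroˡ _)) -0#≈0#))
                                                (+-identityʳ _)))
    ... | no w≢i  | yes w≡j = sym (trans (difference-scaled _ (δ-≢ w≢i) (δ-≡ w≡j))
                                         (trans (+-cong (zeroˡ _) (-‿cong (*-identityˡ _))) (+-identityˡ _)))
    ... | no w≢i  | no w≢j  = sym (trans (difference-scaled _ (δ-≢ w≢i) (δ-≢ w≢j))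
                                         (trans (+-cong (zeroˡ _) (trans (-‿cong (zeroˡ _)) -0#≈0#))
                                                (+-identityʳ 0#)))

    -- the x-coordinates of the potential, i.e. the coefficients of the column operation
    a : Fin n → Carrier
    a v = fromℤ (proj₁ (pot v))

    last-column-shift : ∀ e → R′ e (inj₂ tt) ≈ R e (inj₂ tt) + sumF n (λ v → a v * R e (inj₁ (v , zero)))
    last-column-shift e = begin
      fromℤ ((a₁ ℤ.+ m₁) ℤ.- b₁) * coord zero (d′ e)
        ≈⟨ *-cong (fromℤ-affine a₁ m₁ b₁) (displacement-invariant e zero) ⟩
      ((A + M) - B) * D
        ≈⟨ solve 4 (λ A M B D → ((A :+ M) :- B) :* D := M :* D :+ (A :- B) :* D) refl A M B D ⟩
      M * D + (A - B) * D
        ≈⟨ +-congˡ (*-congʳ (sym (sumF-incidence n a i j))) ⟩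
      M * D + sumF n (λ v → a v * (δ v i - δ v j)) * D
        ≈⟨ +-congˡ (sym (sumF-*ʳ n _ D)) ⟩
      M * D + sumF n (λ v → (a v * (δ v i - δ v j)) * D)
        ≈⟨ +-congˡ (sumF-cong n (λ v → trans (*-assoc _ _ _) (*-congˡ (sym (vertex-entry e v zero))))) ⟩
      M * D + sumF n (λ v → a v * R e (inj₁ (v , zero))) ∎
      where
      i = src G e ; j = tgt G e
      a₁ = proj₁ (pot i) ; m₁ = proj₁ (gain G e) ; b₁ = proj₁ (pot j)
      A = fromℤ a₁ ; M = fromℤ m₁ ; B = fromℤ b₁ ; D = coord zero (d e)

    rank-preserved : ∀ r → HasRank R r ⇔ HasRank R′ r
    rank-preserved = rank-invariant R R′ (column-operation R R′ a vertex-columns-agree last-column-shift)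

theorem2p2 : ∀ {c ℓ} (F : Field c ℓ) →
    let open Field F using (Carrier) in
    let open LinAlg F in
    ∀ {n k : ℕ} (x y₁ y₂ : Carrier) (G : GainGraph n k) (p : Fin n → Vec2)
      (T : Fin k → Bool) (u : Fin n) (pot : Fin n → Gain) →
    Connected G →
    IsSpanningTree G T →
    IsTPotential G T u pot →
    let p′ = λ i → p i ⊕ mulL x y₁ y₂ (pot i) in
    ∀ (r : ℕ) →
      HasRank (rigidity x y₁ y₂ G p) r ⇔
      HasRank (rigidity x y₁ y₂ (withGains G (TGain G pot)) p′) r
theorem2p2 F x y₁ y₂ G p T u pot _ _ _ =
  RigidityRank.Frameworks.rank-preserved F x y₁ y₂ G p pot
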